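{- Let $H$ be a graph and let $C$ be a shortest odd cycle in $H$. Let $X,Y\subseteq E(H)$ be Eulerian edge sets with $|X|\equiv|Y|\pmod 2$. Set $X_1=X\setminus E(C)$ and $Y_1=Y\setminus E(C)$. Then $|Y|\leq|X|+2|Y_1\setminus X_1|$.
   Context: A set of edges $E\subseteq E(H)$ is Eulerian if every vertex of $H$ is incident to an even number of edges of $E$ (the subgraph it induces need not be connected). -}

module Defs where

open import Data.Nat using (ℕ; zero; suc; _≤_; _%_)
open import Data.Nat.Divisibility using (_∣_)
open import Data.Fin using (Fin; zero; suc; toℕ; fromℕ<)
open import Data.Fin.Subset using (Subset; ∣_∣; _∩_)
open import Data.Fin.Properties using (_≟_; any?)
open import Data.Nat.DivMod using (m%n<n)
open import Data.Vec using (tabulate)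
open import Data.Product using (Σ; _×_; ∃)
open import Data.Sum using (_⊎_)
open import Data.Sum.Properties using () 
open import Relation.Nullary using (¬_; Dec)
open import Relation.Nullary.Decidable using (⌊_⌋; _⊎-dec_; _×-dec_)
open import Relation.Binary.PropositionalEquality using (_≡_; _≢_)
open import Function.Definitions using (Injective)

record Graph : Set where
  field
    n     : ℕ
    m     : ℕ
    end₁  : Fin m → Fin n
    end₂  : Fin m → Fin n
    loopless : ∀ e → end₁ e ≢ end₂ e
    simple   : ∀ e f → ((end₁ e ≡ end₁ f × end₂ e ≡ end₂ f)
                        ⊎ (end₁ e ≡ end₂ f × end₂ e ≡ end₁ f)) → e ≡ f
open Graph public

Joins : (H : Graph) → Fin (m H) → Fin (n H) → Fin (n H) → Set
Joins H e x y = (end₁ H e ≡ x × end₂ H e ≡ y) ⊎ (end₁ H e ≡ y × end₂ H e ≡ x)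

joins? : (H : Graph) → ∀ e x y → Dec (Joins H e x y)
joins? H e x y = ((end₁ H e ≟ x) ×-dec (end₂ H e ≟ y)) ⊎-dec ((end₁ H e ≟ y) ×-dec (end₂ H e ≟ x))

Adjacent : (H : Graph) → Fin (n H) → Fin (n H) → Set
Adjacent H x y = ∃ λ e → Joins H e x y

EdgeSet : Graph → Set
EdgeSet H = Subset (m H)

incident : (H : Graph) → Fin (n H) → EdgeSet H
incident H x = tabulate λ e → ⌊ (end₁ H e ≟ x) ⊎-dec (end₂ H e ≟ x) ⌋

Eulerian : (H : Graph) → EdgeSet H → Set
Eulerian H S = ∀ x → 2 ∣ ∣ S ∩ incident H x ∣

next : ∀ {k} → Fin (suc k) → Fin (suc k)
next {k} i = fromℕ< (m%n<n (suc (toℕ i)) (suc k))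

record Cycle (H : Graph) (k : ℕ) : Set where
  field
    len≥3  : 3 ≤ suc k
    vert   : Fin (suc k) → Fin (n H)
    distinct : Injective _≡_ _≡_ vert
    adj    : ∀ i → Adjacent H (vert i) (vert (next i))
open Cycle public

-- length of a cycle of type Cycle H k is suc k
-- E(C): the edges of the cycle
cycleEdges : {H : Graph} {k : ℕ} → Cycle H k → EdgeSet H
cycleEdges {H} C = tabulate λ e → ⌊ any? (λ i → joins? H e (vert C i) (vert C (next i))) ⌋

Odd : ℕ → Set
Odd k = ¬ (2 ∣ k)

ShortestOddCycle : (H : Graph) (k : ℕ) → Cycle H k → Set
ShortestOddCycle H k C = Odd (suc k) × (∀ k′ → Cycle H k′ → Odd (suc k′) → suc k ≤ suc k′)

module Submission where

-- Let E be the edge set of C and W = X ⊕ Y ⊕ E.  Symmetric differences of Eulerian sets are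
-- Eulerian, and as |X| ≡ |Y| (mod 2) and |E| is odd, |W| is odd.  An odd Eulerian set is at
-- least as large as a shortest odd cycle: walking along it without backtracking closes a
-- cycle; if that cycle is odd we are done, and otherwise removing it leaves a smaller odd
-- Eulerian set.  So |E| ≤ |W|.  Edge by edge one checks
-- |Y| + |X ⊕ Y ⊕ E| ≤ |X| + 2 |(Y ∖ E) ∖ (X ∖ E)| + |E|, and cancelling gives the claim.

open import Defs
open import Algebra.Core using (Op₂)
open import Data.Bool using (true; false; _xor_; _∧_)
open import Data.Bool.Properties using (T-≡)
open import Data.Empty using (⊥-elim)
open import Data.Fin using (Fin; zero; suc; toℕ; fromℕ; fromℕ<; inject₁)
open import Data.Fin.Properties
  using (toℕ-fromℕ<; toℕ-injective; toℕ<n; toℕ-fromℕ; toℕ-inject₁; any?; _≟_; pigeonhole)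
import Data.Fin.Properties as Finₚ
open import Data.Fin.Subset using (Subset; Side; inside; outside; _⊆_; _∈_; _∉_; _-_; ∣_∣; _∩_; _─_; ⊤)
open import Data.Fin.Subset.Properties
  using (∩-identityʳ; ∣p∩q∣≤∣q∣; p⊆q⇒∣p∣≤∣q∣; x∈p∩q⁺; x∈p∩q⁻; p─⊥≡p; p─q⊆p; x∈⁅x⁆;
         x∈p∧x≢y⇒x∈p-y; Empty-unique; ∣⊥∣≡0; _∈?_; nonempty?)
open import Data.Nat using (ℕ; zero; suc; _+_; _*_; _%_; _≤_; _<_; z≤n; s≤s; s≤s⁻¹)
open import Data.Nat.DivMod using (m<n⇒m%n≡m; n%n≡0; %-distribˡ-+; m*n%n≡0)
open import Data.Nat.Divisibility
  using (_∣_; _∣?_; _∣0; ∣-refl; ∣1⇒≡1; ∣m∣n⇒∣m+n; ∣m+n∣m⇒∣n; m∣m*n; m%n≡0⇒n∣m)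
open import Data.Nat.Induction using (<-wellFounded)
open import Data.Nat.Properties
  using (+-commutativeSemigroup; +-comm; +-assoc; +-identityʳ; *-comm; *-zeroʳ; *-distribˡ-+;
         +-cancelʳ-≡; +-cancelʳ-≤; +-mono-≤; +-monoʳ-≤; +-monoˡ-<; ≤-refl; ≤-trans; ≤-antisym;
         <⇒≤; <⇒≢; <-cmp; n<1+n; m<m+n; 1+n≢n; m≢1+n+m; suc-injective; m≤n⇒m<n∨m≡n;
         m≤n⇒∃[o]m+o≡n; module ≤-Reasoning)
open import Data.Product using (Σ; ∃; ∃₂; _,_; _×_; proj₁; proj₂)
open import Data.Sum as Sum using (_⊎_; inj₁; inj₂; swap)
open import Data.Vec using ([]; _∷_; zipWith; head; here; there; tabulate)
open import Data.Vec.Properties using (lookup∘tabulate; lookup⇒[]=; []=⇒lookup)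
open import Function.Base using (_∘_; case_of_)
open import Function.Bundles using (_⇔_; mk⇔; Equivalence)
open import Function.Definitions using (Injective)
open import Induction.WellFounded using (Acc; acc)
open import Relation.Binary.Definitions using (tri<; tri≈; tri>)
open import Relation.Binary.PropositionalEquality
open import Relation.Nullary using (¬_; yes; no; ¬?)
open import Relation.Nullary.Decidable using (⌊_⌋; fromWitness; toWitness; _×-dec_; decidable-stable)
open import Relation.Unary using (Pred; Decidable)

open import Algebra.Properties.CommutativeSemigroup +-commutativeSemigroup using (interchange)

-- Symmetric difference and counting

infixl 6 _⊕_

_⊕_ : ∀ {n} → Op₂ (Subset n)
p ⊕ q = zipWith _xor_ p q

𝟙 : Side → ℕ
𝟙 inside  = 1
𝟙 outside = 0

Weight : Set
Weight = Side → Side → Side → ℕ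

Σ₃ : ∀ {n} → Weight → Subset n → Subset n → Subset n → ℕ
Σ₃ w []      []      []      = 0
Σ₃ w (a ∷ p) (b ∷ q) (c ∷ r) = w a b c + Σ₃ w p q r

Σ₃-+ : ∀ (v w : Weight) {n} (p q r : Subset n) →
       Σ₃ v p q r + Σ₃ w p q r ≡ Σ₃ (λ a b c → v a b c + w a b c) p q r
Σ₃-+ v w []      []      []      = refl
Σ₃-+ v w (a ∷ p) (b ∷ q) (c ∷ r) =
  trans (interchange (v a b c) _ (w a b c) _) (cong (v a b c + w a b c +_) (Σ₃-+ v w p q r))

Σ₃-* : ∀ k (w : Weight) {n} (p q r : Subset n) →
       k * Σ₃ w p q r ≡ Σ₃ (λ a b c → k * w a b c) p q r
Σ₃-* k w []      []      []      = *-zeroʳ k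
Σ₃-* k w (a ∷ p) (b ∷ q) (c ∷ r) =
  trans (*-distribˡ-+ k (w a b c) _) (cong (k * w a b c +_) (Σ₃-* k w p q r))

Σ₃-mono-≤ : ∀ {v w : Weight} → (∀ a b c → v a b c ≤ w a b c) →
            ∀ {n} (p q r : Subset n) → Σ₃ v p q r ≤ Σ₃ w p q r
Σ₃-mono-≤ v≤w []      []      []      = z≤n
Σ₃-mono-≤ v≤w (a ∷ p) (b ∷ q) (c ∷ r) = +-mono-≤ (v≤w a b c) (Σ₃-mono-≤ v≤w p q r)

Σ₃-cong : ∀ {v w : Weight} → (∀ a b c → v a b c ≡ w a b c) →
          ∀ {n} (p q r : Subset n) → Σ₃ v p q r ≡ Σ₃ w p q r
Σ₃-cong v≡w []      []      []      = refl
Σ₃-cong v≡w (a ∷ p) (b ∷ q) (c ∷ r) = cong₂ _+_ (v≡w a b c) (Σ₃-cong v≡w p q r)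

-- The componentwise operation of _─_, which Data.Fin.Subset keeps local.
infixl 5 _─ₛ_
_─ₛ_ : Side → Side → Side
a ─ₛ b = head ((a ∷ []) ─ (b ∷ []))

Op₃ : Set
Op₃ = ∀ {n} → Subset n → Subset n → Subset n → Subset n

Componentwise : Op₃ → (Side → Side → Side → Side) → Set
Componentwise op f = ∀ {n} a b c (p q r : Subset n) →
                     op (a ∷ p) (b ∷ q) (c ∷ r) ≡ f a b c ∷ op p q r

∣componentwise∣≡Σ₃ : ∀ {op : Op₃} {f} → Componentwise op f → ∀ {n} (p q r : Subset n) →
                     ∣ op p q r ∣ ≡ Σ₃ (λ a b c → 𝟙 (f a b c)) p q r
∣componentwise∣≡Σ₃ {op} {f} op≡ []      []      []      with op [] [] []
... | [] = refl
∣componentwise∣≡Σ₃ {op} {f} op≡ (a ∷ p) (b ∷ q) (c ∷ r) rewrite op≡ a b c p q r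
  with f a b c
... | inside  = cong suc (∣componentwise∣≡Σ₃ op≡ p q r)
... | outside = ∣componentwise∣≡Σ₃ op≡ p q r

module _ {n : ℕ} (p q r : Subset n) where

  private
    count : ∀ (op : Op₃) {f} → Componentwise op f →
            ∣ op p q r ∣ ≡ Σ₃ (λ a b c → 𝟙 (f a b c)) p q r
    count op op≡ = ∣componentwise∣≡Σ₃ op≡ p q r

  ∣p⊕q∩r∣+2∣p∩q∩r∣≡∣p∩r∣+∣q∩r∣ : ∣ (p ⊕ q) ∩ r ∣ + 2 * ∣ p ∩ q ∩ r ∣ ≡ ∣ p ∩ r ∣ + ∣ q ∩ r ∣
  ∣p⊕q∩r∣+2∣p∩q∩r∣≡∣p∩r∣+∣q∩r∣ = begin
      ∣ (p ⊕ q) ∩ r ∣ + 2 * ∣ p ∩ q ∩ r ∣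
    ≡⟨ cong₂ (λ s t → s + 2 * t) (count (λ p q r → (p ⊕ q) ∩ r) λ _ _ _ _ _ _ → refl)
                                 (count (λ p q r → p ∩ q ∩ r) λ _ _ _ _ _ _ → refl) ⟩
      Σ₃ (λ a b c → 𝟙 ((a xor b) ∧ c)) p q r + 2 * Σ₃ (λ a b c → 𝟙 (a ∧ b ∧ c)) p q r
    ≡⟨ cong (Σ₃ (λ a b c → 𝟙 ((a xor b) ∧ c)) p q r +_) (Σ₃-* 2 _ p q r) ⟩
      Σ₃ (λ a b c → 𝟙 ((a xor b) ∧ c)) p q r + Σ₃ (λ a b c → 2 * 𝟙 (a ∧ b ∧ c)) p q r
    ≡⟨ Σ₃-+ _ _ p q r ⟩
      Σ₃ (λ a b c → 𝟙 ((a xor b) ∧ c) + 2 * 𝟙 (a ∧ b ∧ c)) p q r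
    ≡⟨ Σ₃-cong pointwise p q r ⟩
      Σ₃ (λ a b c → 𝟙 (a ∧ c) + 𝟙 (b ∧ c)) p q r
    ≡⟨ Σ₃-+ _ _ p q r ⟨
      Σ₃ (λ a b c → 𝟙 (a ∧ c)) p q r + Σ₃ (λ a b c → 𝟙 (b ∧ c)) p q r
    ≡⟨ cong₂ _+_ (count (λ p q r → p ∩ r) λ _ _ _ _ _ _ → refl)
                 (count (λ p q r → q ∩ r) λ _ _ _ _ _ _ → refl) ⟨
      ∣ p ∩ r ∣ + ∣ q ∩ r ∣ ∎
    where
    open ≡-Reasoning
    pointwise : ∀ a b c → 𝟙 ((a xor b) ∧ c) + 2 * 𝟙 (a ∧ b ∧ c) ≡ 𝟙 (a ∧ c) + 𝟙 (b ∧ c)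
    pointwise true  true  true  = refl
    pointwise true  true  false = refl
    pointwise true  false true  = refl
    pointwise true  false false = refl
    pointwise false true  true  = refl
    pointwise false true  false = refl
    pointwise false false true  = refl
    pointwise false false false = refl

  ∣q∣+∣p⊕q⊕r∣≤∣p∣+2∣q─r─[p─r]∣+∣r∣ : ∣ q ∣ + ∣ p ⊕ q ⊕ r ∣ ≤ ∣ p ∣ + 2 * ∣ q ─ r ─ (p ─ r) ∣ + ∣ r ∣
  ∣q∣+∣p⊕q⊕r∣≤∣p∣+2∣q─r─[p─r]∣+∣r∣ = begin
      ∣ q ∣ + ∣ p ⊕ q ⊕ r ∣
    ≡⟨ cong₂ _+_ (count (λ p q r → q) λ _ _ _ _ _ _ → refl)
                 (count (λ p q r → p ⊕ q ⊕ r) λ _ _ _ _ _ _ → refl) ⟩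
      Σ₃ (λ a b c → 𝟙 b) p q r + Σ₃ (λ a b c → 𝟙 ((a xor b) xor c)) p q r
    ≡⟨ Σ₃-+ _ _ p q r ⟩
      Σ₃ (λ a b c → 𝟙 b + 𝟙 ((a xor b) xor c)) p q r
    ≤⟨ Σ₃-mono-≤ pointwise p q r ⟩
      Σ₃ (λ a b c → 𝟙 a + 2 * 𝟙 (b ─ₛ c ─ₛ (a ─ₛ c)) + 𝟙 c) p q r
    ≡⟨ Σ₃-+ _ _ p q r ⟨
      Σ₃ (λ a b c → 𝟙 a + 2 * 𝟙 (b ─ₛ c ─ₛ (a ─ₛ c))) p q r + Σ₃ (λ a b c → 𝟙 c) p q r
    ≡⟨ cong (_+ Σ₃ (λ a b c → 𝟙 c) p q r) (Σ₃-+ _ _ p q r) ⟨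
      Σ₃ (λ a b c → 𝟙 a) p q r + Σ₃ (λ a b c → 2 * 𝟙 (b ─ₛ c ─ₛ (a ─ₛ c))) p q r
        + Σ₃ (λ a b c → 𝟙 c) p q r
    ≡⟨ cong (λ t → Σ₃ (λ a b c → 𝟙 a) p q r + t + Σ₃ (λ a b c → 𝟙 c) p q r) (Σ₃-* 2 _ p q r) ⟨
      Σ₃ (λ a b c → 𝟙 a) p q r + 2 * Σ₃ (λ a b c → 𝟙 (b ─ₛ c ─ₛ (a ─ₛ c))) p q r
        + Σ₃ (λ a b c → 𝟙 c) p q r
    ≡⟨ cong₂ (λ s t → s + 2 * t + Σ₃ (λ a b c → 𝟙 c) p q r)
             (count (λ p q r → p) λ _ _ _ _ _ _ → refl)
             (count (λ p q r → q ─ r ─ (p ─ r)) {λ a b c → b ─ₛ c ─ₛ (a ─ₛ c)} λ _ _ _ _ _ _ → refl) ⟨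
      ∣ p ∣ + 2 * ∣ q ─ r ─ (p ─ r) ∣ + Σ₃ (λ a b c → 𝟙 c) p q r
    ≡⟨ cong (∣ p ∣ + 2 * ∣ q ─ r ─ (p ─ r) ∣ +_) (count (λ p q r → r) λ _ _ _ _ _ _ → refl) ⟨
      ∣ p ∣ + 2 * ∣ q ─ r ─ (p ─ r) ∣ + ∣ r ∣ ∎
    where
    open ≤-Reasoning
    pointwise : ∀ a b c → 𝟙 b + 𝟙 ((a xor b) xor c) ≤ 𝟙 a + 2 * 𝟙 (b ─ₛ c ─ₛ (a ─ₛ c)) + 𝟙 c
    pointwise true  true  true  = ≤-refl
    pointwise true  true  false = ≤-refl
    pointwise true  false true  = z≤n
    pointwise true  false false = ≤-refl
    pointwise false true  true  = ≤-refl
    pointwise false true  false = ≤-refl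
    pointwise false false true  = ≤-refl
    pointwise false false false = ≤-refl

∣p⊕q∣+2∣p∩q∣≡∣p∣+∣q∣ : ∀ {n} (p q : Subset n) → ∣ p ⊕ q ∣ + 2 * ∣ p ∩ q ∣ ≡ ∣ p ∣ + ∣ q ∣
∣p⊕q∣+2∣p∩q∣≡∣p∣+∣q∣ p q = begin
    ∣ p ⊕ q ∣ + 2 * ∣ p ∩ q ∣
  ≡⟨ cong₂ (λ s t → ∣ s ∣ + 2 * ∣ p ∩ t ∣) (∩-identityʳ (p ⊕ q)) (∩-identityʳ q) ⟨
    ∣ (p ⊕ q) ∩ ⊤ ∣ + 2 * ∣ p ∩ q ∩ ⊤ ∣
  ≡⟨ ∣p⊕q∩r∣+2∣p∩q∩r∣≡∣p∩r∣+∣q∩r∣ p q ⊤ ⟩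
    ∣ p ∩ ⊤ ∣ + ∣ q ∩ ⊤ ∣
  ≡⟨ cong₂ (λ s t → ∣ s ∣ + ∣ t ∣) (∩-identityʳ p) (∩-identityʳ q) ⟩
    ∣ p ∣ + ∣ q ∣ ∎
  where open ≡-Reasoning

⊆⇒∣p⊕q∣+∣q∣≡∣p∣ : ∀ {n} {p q : Subset n} → q ⊆ p → ∣ p ⊕ q ∣ + ∣ q ∣ ≡ ∣ p ∣
⊆⇒∣p⊕q∣+∣q∣≡∣p∣ {p = p} {q} q⊆p = +-cancelʳ-≡ ∣ q ∣ _ _ (begin
    ∣ p ⊕ q ∣ + ∣ q ∣ + ∣ q ∣
  ≡⟨ +-assoc (∣ p ⊕ q ∣) (∣ q ∣) (∣ q ∣) ⟩
    ∣ p ⊕ q ∣ + (∣ q ∣ + ∣ q ∣)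
  ≡⟨ cong (λ t → ∣ p ⊕ q ∣ + (t + t)) ∣p∩q∣≡∣q∣ ⟨
    ∣ p ⊕ q ∣ + (∣ p ∩ q ∣ + ∣ p ∩ q ∣)
  ≡⟨ cong (λ t → ∣ p ⊕ q ∣ + (∣ p ∩ q ∣ + t)) (+-identityʳ _) ⟨
    ∣ p ⊕ q ∣ + 2 * ∣ p ∩ q ∣
  ≡⟨ ∣p⊕q∣+2∣p∩q∣≡∣p∣+∣q∣ p q ⟩
    ∣ p ∣ + ∣ q ∣ ∎)
  where
  open ≡-Reasoning
  ∣p∩q∣≡∣q∣ : ∣ p ∩ q ∣ ≡ ∣ q ∣
  ∣p∩q∣≡∣q∣ = ≤-antisym (∣p∩q∣≤∣q∣ p q) (p⊆q⇒∣p∣≤∣q∣ λ x∈q → x∈p∩q⁺ (q⊆p x∈q , x∈q))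

m+2n≡o⇒[2∣m⇔2∣o] : ∀ {m} n {o} → m + 2 * n ≡ o → (2 ∣ m) ⇔ (2 ∣ o)
m+2n≡o⇒[2∣m⇔2∣o] {m} n refl = mk⇔
  (λ 2∣m → ∣m∣n⇒∣m+n 2∣m (m∣m*n n))
  (λ 2∣o → ∣m+n∣m⇒∣n (subst (2 ∣_) (+-comm m (2 * n)) 2∣o) (m∣m*n n))

2∣∣p⊕q∣⇔2∣∣p∣+∣q∣ : ∀ {n} (p q : Subset n) → (2 ∣ ∣ p ⊕ q ∣) ⇔ (2 ∣ ∣ p ∣ + ∣ q ∣)
2∣∣p⊕q∣⇔2∣∣p∣+∣q∣ p q = m+2n≡o⇒[2∣m⇔2∣o] ∣ p ∩ q ∣ (∣p⊕q∣+2∣p∩q∣≡∣p∣+∣q∣ p q)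

m%2≡n%2⇒2∣m+n : ∀ m n → m % 2 ≡ n % 2 → 2 ∣ m + n
m%2≡n%2⇒2∣m+n m n eq = m%n≡0⇒n∣m (m + n) 2 (begin
    (m + n) % 2           ≡⟨ %-distribˡ-+ m n 2 ⟩
    (m % 2 + n % 2) % 2   ≡⟨ cong (λ t → (t + n % 2) % 2) eq ⟩
    (n % 2 + n % 2) % 2   ≡⟨ cong (λ t → (n % 2 + t) % 2) (+-identityʳ (n % 2)) ⟨
    (2 * (n % 2)) % 2     ≡⟨ cong (_% 2) (*-comm 2 (n % 2)) ⟩
    (n % 2 * 2) % 2       ≡⟨ m*n%n≡0 (n % 2) 2 ⟩
    0                     ∎)
  where open ≡-Reasoning

-- Enumerated subsets

x∈p─q⇒x∉q : ∀ {n} {p q : Subset n} {x} → x ∈ p ─ q → x ∉ q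
x∈p─q⇒x∉q {p = _ ∷ _} {outside ∷ _} here       ()
x∈p─q⇒x∉q {p = _ ∷ _} {_ ∷ _}       (there x∈) (there x∈q) = x∈p─q⇒x∉q x∈ x∈q

x∈p⇒∣p∣≡1+∣p-x∣ : ∀ {n} {p : Subset n} {x} → x ∈ p → ∣ p ∣ ≡ suc ∣ p - x ∣
x∈p⇒∣p∣≡1+∣p-x∣ {p = inside ∷ p} here = cong (suc ∘ ∣_∣) (sym (p─⊥≡p p))
x∈p⇒∣p∣≡1+∣p-x∣ {p = inside  ∷ _} (there x∈p) = cong suc (x∈p⇒∣p∣≡1+∣p-x∣ x∈p)
x∈p⇒∣p∣≡1+∣p-x∣ {p = outside ∷ _} (there x∈p) = x∈p⇒∣p∣≡1+∣p-x∣ x∈p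

record Enumeration {n} (p : Subset n) (L : ℕ) : Set where
  field
    element   : Fin L → Fin n
    injective : Injective _≡_ _≡_ element
    member    : ∀ i → element i ∈ p
    complete  : ∀ {x} → x ∈ p → ∃ λ i → element i ≡ x
open Enumeration

enumeration⇒∣p∣≡L : ∀ {n L} {p : Subset n} → Enumeration p L → ∣ p ∣ ≡ L
enumeration⇒∣p∣≡L {n} {zero} E =
  trans (cong ∣_∣ (Empty-unique λ (_ , x∈p) → case complete E x∈p of λ ())) (∣⊥∣≡0 n)
enumeration⇒∣p∣≡L {L = suc L} {p} E =
  trans (x∈p⇒∣p∣≡1+∣p-x∣ (member E zero)) (cong suc (enumeration⇒∣p∣≡L E′))
  where
  E′ : Enumeration (p - element E zero) L
  element   E′ = element E ∘ suc
  injective E′ = Finₚ.suc-injective ∘ injective E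
  member    E′ i = x∈p∧x≢y⇒x∈p-y (member E (suc i)) λ eq → case injective E eq of λ ()
  complete  E′ x∈p-x₀ with complete E (p─q⊆p _ _ x∈p-x₀)
  ... | zero  , refl = ⊥-elim (x∈p─q⇒x∉q x∈p-x₀ (x∈⁅x⁆ _))
  ... | suc i , eq   = i , eq

∈tabulate⁺ : ∀ {n ℓ} {P : Pred (Fin n) ℓ} (P? : Decidable P) {x} →
             P x → x ∈ tabulate (λ y → ⌊ P? y ⌋)
∈tabulate⁺ P? {x} Px =
  lookup⇒[]= x _ (trans (lookup∘tabulate _ x) (Equivalence.to T-≡ (fromWitness Px)))

∈tabulate⁻ : ∀ {n ℓ} {P : Pred (Fin n) ℓ} (P? : Decidable P) {x} →
             x ∈ tabulate (λ y → ⌊ P? y ⌋) → P x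
∈tabulate⁻ P? {x} x∈ =
  toWitness (Equivalence.from T-≡ (trans (sym (lookup∘tabulate _ x)) ([]=⇒lookup x∈)))

-- Graphs and cycles

module _ (H : Graph) where

  joins-sym : ∀ {e x y} → Joins H e x y → Joins H e y x
  joins-sym = swap

  joins-irreflexive : ∀ {e x} → ¬ Joins H e x x
  joins-irreflexive {e} (inj₁ (e₁≡x , e₂≡x)) = loopless H e (trans e₁≡x (sym e₂≡x))
  joins-irreflexive {e} (inj₂ (e₁≡x , e₂≡x)) = loopless H e (trans e₁≡x (sym e₂≡x))

  joins-ends : ∀ {e x y u v} → Joins H e x y → Joins H e u v → (x ≡ u × y ≡ v) ⊎ (x ≡ v × y ≡ u)
  joins-ends (inj₁ (a , b)) (inj₁ (c , d)) = inj₁ (trans (sym a) c , trans (sym b) d)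
  joins-ends (inj₁ (a , b)) (inj₂ (c , d)) = inj₂ (trans (sym a) c , trans (sym b) d)
  joins-ends (inj₂ (a , b)) (inj₁ (c , d)) = inj₂ (trans (sym b) d , trans (sym a) c)
  joins-ends (inj₂ (a , b)) (inj₂ (c , d)) = inj₁ (trans (sym b) d , trans (sym a) c)

  joins-endpoint : ∀ {e x y u v} → Joins H e x y → Joins H e u v → u ≡ x ⊎ u ≡ y
  joins-endpoint Jxy Juv = Sum.map (sym ∘ proj₁) (sym ∘ proj₂) (joins-ends Jxy Juv)

  joins-unique : ∀ {e f x y} → Joins H e x y → Joins H f x y → e ≡ f
  joins-unique {e} {f} (inj₁ (a , b)) (inj₁ (c , d)) = simple H e f (inj₁ (trans a (sym c) , trans b (sym d)))
  joins-unique {e} {f} (inj₁ (a , b)) (inj₂ (c , d)) = simple H e f (inj₂ (trans a (sym d) , trans b (sym c)))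
  joins-unique {e} {f} (inj₂ (a , b)) (inj₁ (c , d)) = simple H e f (inj₂ (trans a (sym d) , trans b (sym c)))
  joins-unique {e} {f} (inj₂ (a , b)) (inj₂ (c , d)) = simple H e f (inj₁ (trans a (sym c) , trans b (sym d)))

  joins⇒∈incident : ∀ {e x y} → Joins H e x y → e ∈ incident H x
  joins⇒∈incident J = ∈tabulate⁺ _ (Sum.map proj₁ proj₂ J)

  ∈incident⇒joins : ∀ {e x} → e ∈ incident H x → ∃ λ y → Joins H e x y
  ∈incident⇒joins {e} e∈ with ∈tabulate⁻ _ e∈
  ... | inj₁ e₁≡x = end₂ H e , inj₁ (e₁≡x , refl)
  ... | inj₂ e₂≡x = end₁ H e , inj₂ (refl , e₂≡x)

Eulerian-⊕ : ∀ (H : Graph) (p q : EdgeSet H) → Eulerian H p → Eulerian H q → Eulerian H (p ⊕ q)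
Eulerian-⊕ H p q p-Eulerian q-Eulerian v =
  Equivalence.from (m+2n≡o⇒[2∣m⇔2∣o] ∣ p ∩ q ∩ incident H v ∣
                                       (∣p⊕q∩r∣+2∣p∩q∩r∣≡∣p∩r∣+∣q∩r∣ p q (incident H v)))
                   (∣m∣n⇒∣m+n (p-Eulerian v) (q-Eulerian v))

module _ {k : ℕ} where

  toℕ-next-< : ∀ (i : Fin (suc k)) → toℕ i < k → toℕ (next i) ≡ suc (toℕ i)
  toℕ-next-< i i<k = trans (toℕ-fromℕ< _) (m<n⇒m%n≡m (s≤s i<k))

  toℕ-next-last : ∀ (i : Fin (suc k)) → toℕ i ≡ k → toℕ (next i) ≡ 0
  toℕ-next-last i i≡k =
    trans (toℕ-fromℕ< _) (trans (cong (λ t → suc t % suc k) i≡k) (n%n≡0 (suc k)))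

  data NextView (i : Fin (suc k)) : Set where
    step : toℕ i < k → toℕ (next i) ≡ suc (toℕ i) → NextView i
    wrap : toℕ i ≡ k → toℕ (next i) ≡ 0 → NextView i

  nextView : ∀ i → NextView i
  nextView i with m≤n⇒m<n∨m≡n (s≤s⁻¹ (toℕ<n i))
  ... | inj₁ i<k = step i<k (toℕ-next-< i i<k)
  ... | inj₂ i≡k = wrap i≡k (toℕ-next-last i i≡k)

  next-injective : Injective _≡_ _≡_ (next {k})
  next-injective {i} {j} eq with nextView i | nextView j | cong toℕ eq
  ... | step _ i′ | step _ j′ | eq′ = toℕ-injective (suc-injective (trans (sym i′) (trans eq′ j′)))
  ... | step _ i′ | wrap _ j′ | eq′ = case trans (sym i′) (trans eq′ j′) of λ ()
  ... | wrap _ i′ | step _ j′ | eq′ = case trans (sym j′) (trans (sym eq′) i′) of λ ()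
  ... | wrap i≡k _ | wrap j≡k _ | _ = toℕ-injective (trans i≡k (sym j≡k))

  next≢id : 1 ≤ k → ∀ i → next i ≢ i
  next≢id 1≤k i eq with nextView i
  ... | step _ i′ = 1+n≢n (trans (sym i′) (cong toℕ eq))
  ... | wrap i≡k i′ = <⇒≢ 1≤k (trans (sym i′) (trans (cong toℕ eq) i≡k))

  next²≢id : 2 ≤ k → ∀ i → next (next i) ≢ i
  next²≢id 2≤k i eq with nextView i | nextView (next i) | cong toℕ eq
  ... | step _ i′ | step _ ni′ | eq′ = m≢1+n+m (toℕ i) (trans (sym eq′) (trans ni′ (cong suc i′)))
  ... | step _ i′ | wrap ni≡k nni′ | eq′ =
    <⇒≢ 2≤k (trans (cong suc (trans (sym nni′) eq′)) (trans (sym i′) ni≡k))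
  ... | wrap i≡k i′ | step _ ni′ | eq′ =
    <⇒≢ 2≤k (trans (sym (trans ni′ (cong suc i′))) (trans eq′ i≡k))
  ... | wrap _ i′ | wrap ni≡k _ | _ = <⇒≢ (≤-trans (s≤s z≤n) 2≤k) (trans (sym i′) ni≡k)

  prev : Fin (suc k) → Fin (suc k)
  prev zero    = fromℕ k
  prev (suc i) = inject₁ i

  next-prev : ∀ i → next (prev i) ≡ i
  next-prev zero    = toℕ-injective (toℕ-next-last (fromℕ k) (toℕ-fromℕ k))
  next-prev (suc i) =
    toℕ-injective (trans (toℕ-next-< (inject₁ i) inject₁i<k) (cong suc (toℕ-inject₁ i)))
    where
    inject₁i<k : toℕ (inject₁ i) < k
    inject₁i<k = subst (_< k) (sym (toℕ-inject₁ i)) (toℕ<n i)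

module _ {H : Graph} {k : ℕ} (C : Cycle H k) where

  cycleEdge : Fin (suc k) → Fin (m H)
  cycleEdge i = proj₁ (adj C i)

  cycleEdge-joins : ∀ i → Joins H (cycleEdge i) (vert C i) (vert C (next i))
  cycleEdge-joins i = proj₂ (adj C i)

  cycleEdge∈cycleEdges : ∀ i → cycleEdge i ∈ cycleEdges C
  cycleEdge∈cycleEdges i = ∈tabulate⁺ _ (i , cycleEdge-joins i)

  ∈cycleEdges⇒≡cycleEdge : ∀ {e} → e ∈ cycleEdges C → ∃ λ i → cycleEdge i ≡ e
  ∈cycleEdges⇒≡cycleEdge e∈ with ∈tabulate⁻ _ e∈
  ... | i , J = i , joins-unique H (cycleEdge-joins i) J

  cycleEdges⊆ : ∀ {S} → (∀ i → cycleEdge i ∈ S) → cycleEdges C ⊆ S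
  cycleEdges⊆ cycleEdge∈S e∈ with ∈cycleEdges⇒≡cycleEdge e∈
  ... | i , refl = cycleEdge∈S i

  cycleEdge-injective : Injective _≡_ _≡_ cycleEdge
  cycleEdge-injective {i} {j} eq
    with joins-ends H (subst (λ e → Joins H e _ _) eq (cycleEdge-joins i)) (cycleEdge-joins j)
  ... | inj₁ (vi≡vj , _)        = distinct C vi≡vj
  ... | inj₂ (vi≡vnj , vni≡vj) =
    ⊥-elim (next²≢id (s≤s⁻¹ (len≥3 C)) j
             (trans (cong next (sym (distinct C vi≡vnj))) (distinct C vni≡vj)))

  ∣cycleEdges∣≡length : ∣ cycleEdges C ∣ ≡ suc k
  ∣cycleEdges∣≡length = enumeration⇒∣p∣≡L record
    { element   = cycleEdge
    ; injective = cycleEdge-injective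
    ; member    = cycleEdge∈cycleEdges
    ; complete  = ∈cycleEdges⇒≡cycleEdge
    }

  ∈cycleEdges∩incident : ∀ {e x} → e ∈ cycleEdges C ∩ incident H x →
                         ∃ λ i → cycleEdge i ≡ e × (x ≡ vert C i ⊎ x ≡ vert C (next i))
  ∈cycleEdges∩incident e∈
    with e∈C , e∈x ← x∈p∩q⁻ _ _ e∈
    with i , refl ← ∈cycleEdges⇒≡cycleEdge e∈C
    with _ , J ← ∈incident⇒joins H e∈x
    = i , refl , joins-endpoint H (cycleEdge-joins i) J

  degree-off-cycle : ∀ {x} → ¬ (∃ λ i → vert C i ≡ x) → ∣ cycleEdges C ∩ incident H x ∣ ≡ 0
  degree-off-cycle x∉C = enumeration⇒∣p∣≡L record
    { element   = λ ()
    ; injective = λ { {()} }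
    ; member    = λ ()
    ; complete  = λ e∈ → case ∈cycleEdges∩incident e∈ of λ where
        (i , _ , inj₁ x≡vi)  → ⊥-elim (x∉C (i , sym x≡vi))
        (i , _ , inj₂ x≡vni) → ⊥-elim (x∉C (next i , sym x≡vni))
    }

  degree-on-cycle : ∀ a → ∣ cycleEdges C ∩ incident H (vert C a) ∣ ≡ 2
  degree-on-cycle a = enumeration⇒∣p∣≡L record
    { element = element₂ ; injective = injective₂ ; member = member₂ ; complete = complete₂ }
    where
    p : Fin (suc k)
    p = prev a

    element₂ : Fin 2 → Fin (m H)
    element₂ zero       = cycleEdge a
    element₂ (suc zero) = cycleEdge p

    a≢p : a ≢ p
    a≢p a≡p = next≢id (≤-trans (s≤s z≤n) (s≤s⁻¹ (len≥3 C))) p (trans (next-prev a) a≡p)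

    injective₂ : Injective _≡_ _≡_ element₂
    injective₂ {zero}     {zero}     _  = refl
    injective₂ {zero}     {suc zero} eq = ⊥-elim (a≢p (cycleEdge-injective eq))
    injective₂ {suc zero} {zero}     eq = ⊥-elim (a≢p (sym (cycleEdge-injective eq)))
    injective₂ {suc zero} {suc zero} _  = refl

    p→a : Joins H (cycleEdge p) (vert C p) (vert C a)
    p→a = subst (Joins H (cycleEdge p) (vert C p) ∘ vert C) (next-prev a) (cycleEdge-joins p)

    member₂ : ∀ i → element₂ i ∈ cycleEdges C ∩ incident H (vert C a)
    member₂ zero       = x∈p∩q⁺ (cycleEdge∈cycleEdges a , joins⇒∈incident H (cycleEdge-joins a))
    member₂ (suc zero) = x∈p∩q⁺ (cycleEdge∈cycleEdges p , joins⇒∈incident H (joins-sym H p→a))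

    complete₂ : ∀ {e} → e ∈ cycleEdges C ∩ incident H (vert C a) → ∃ λ i → element₂ i ≡ e
    complete₂ e∈ with ∈cycleEdges∩incident e∈
    ... | b , refl , inj₁ va≡vb  = zero , cong cycleEdge (distinct C va≡vb)
    ... | b , refl , inj₂ va≡vnb =
      suc zero , cong cycleEdge (next-injective (trans (next-prev a) (distinct C va≡vnb)))

  cycleEdges-Eulerian : Eulerian H (cycleEdges C)
  cycleEdges-Eulerian x with any? (λ i → vert C i ≟ x)
  ... | no x∉C         = subst (2 ∣_) (sym (degree-off-cycle x∉C)) (2 ∣0)
  ... | yes (a , refl) = subst (2 ∣_) (sym (degree-on-cycle a)) ∣-refl

-- Walks in Eulerian sets

least : ∀ {ℓ} {P : Pred ℕ ℓ} → Decidable P → ∀ {n} → P n → ∃ λ j → P j × (∀ {i} → i < j → ¬ P i)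
least P? {zero} P0 = 0 , P0 , λ ()
least P? {suc n} Pn with P? 0
... | yes P0 = 0 , P0 , λ ()
... | no ¬P0 with least (P? ∘ suc) Pn
...   | j , Pj , below = suc j , Pj , λ { {zero} _ → ¬P0 ; {suc i} i<j → below (s≤s⁻¹ i<j) }

module _ {n : ℕ} (f : ℕ → Fin n) where

  Repeats : ℕ → Set
  Repeats j = ∃ λ (i : Fin j) → f (toℕ i) ≡ f j

  <-repeats : ∀ {a b} → a < b → f a ≡ f b → Repeats b
  <-repeats {a} {b} a<b eq = fromℕ< a<b , subst (λ t → f t ≡ f b) (sym (toℕ-fromℕ< a<b)) eq

  first-repetition : ∃₂ λ i j → i < j × f i ≡ f j × (∀ {a b} → a < j → b < j → f a ≡ f b → a ≡ b)
  first-repetition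
    with i₀ , j₀ , i₀<j₀ , fi₀≡fj₀ ← pigeonhole (n<1+n n) (f ∘ toℕ)
    with j , (i , fi≡fj) , no-earlier ←
           least (λ j → any? λ i → f (toℕ i) ≟ f j) (<-repeats i₀<j₀ fi₀≡fj₀)
    = toℕ i , j , toℕ<n i , fi≡fj , injective-below
    where
    injective-below : ∀ {a b} → a < j → b < j → f a ≡ f b → a ≡ b
    injective-below {a} {b} a<j b<j fa≡fb with <-cmp a b
    ... | tri< a<b _ _ = ⊥-elim (no-earlier b<j (<-repeats a<b fa≡fb))
    ... | tri≈ _ a≡b _ = a≡b
    ... | tri> _ _ b<a = ⊥-elim (no-earlier a<j (<-repeats b<a (sym fa≡fb)))

<⇒≡suc+ : ∀ {i j} → i < j → ∃ λ k → j ≡ suc k + i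
<⇒≡suc+ {i} i<j with k , i+k≡j ← m≤n⇒∃[o]m+o≡n i<j = k , trans (sym i+k≡j) (cong suc (+-comm i k))

record NonBacktrackingWalk (H : Graph) (S : EdgeSet H) : Set where
  field
    vertex       : ℕ → Fin (n H)
    edge         : ℕ → Fin (m H)
    edge∈S       : ∀ t → edge t ∈ S
    edge-joins   : ∀ t → Joins H (edge t) (vertex t) (vertex (suc t))
    no-backtrack : ∀ t → edge (suc t) ≢ edge t

module _ (H : Graph) (S : EdgeSet H) (S-Eulerian : Eulerian H S) where

  another-edge : ∀ {e v} → e ∈ S → e ∈ incident H v → ∃ λ f → f ∈ S ∩ incident H v × f ≢ e
  another-edge {e} {v} e∈S e∈v with any? (λ f → (f ∈? S ∩ incident H v) ×-dec ¬? (f ≟ e))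
  ... | yes found = found
  ... | no none   =
    ⊥-elim (case ∣1⇒≡1 (subst (2 ∣_) (enumeration⇒∣p∣≡L only-e) (S-Eulerian v)) of λ ())
    where
    only-e : Enumeration (S ∩ incident H v) 1
    only-e = record
      { element   = λ _ → e
      ; injective = λ { {zero} {zero} _ → refl }
      ; member    = λ _ → x∈p∩q⁺ (e∈S , e∈v)
      ; complete  = λ {f} f∈ → zero , sym (decidable-stable (f ≟ e) λ f≢e → none (f , f∈ , f≢e))
      }

  record Arrival : Set where
    field
      at     : Fin (n H)
      via    : Fin (m H)
      via∈S  : via ∈ S
      via-at : via ∈ incident H at
  open Arrival

  depart : (a : Arrival) → Σ Arrival λ b → Joins H (via b) (at a) (at b) × via b ≢ via a
  depart a with another-edge (via∈S a) (via-at a)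
  ... | f , f∈ , f≢ with x∈p∩q⁻ S (incident H (at a)) f∈
  ... | f∈S , f∈a with ∈incident⇒joins H f∈a
  ... | u , J =
    record { at = u ; via = f ; via∈S = f∈S ; via-at = joins⇒∈incident H (joins-sym H J) } , J , f≢

  Eulerian⇒walk : ∀ {e} → e ∈ S → NonBacktrackingWalk H S
  Eulerian⇒walk {e} e∈S = record
    { vertex       = at ∘ arrival
    ; edge         = via ∘ arrival ∘ suc
    ; edge∈S       = via∈S ∘ arrival ∘ suc
    ; edge-joins   = proj₁ ∘ proj₂ ∘ depart ∘ arrival
    ; no-backtrack = proj₂ ∘ proj₂ ∘ depart ∘ arrival ∘ suc
    }
    where
    arrival : ℕ → Arrival
    arrival zero    = record
      { at = end₁ H e ; via = e ; via∈S = e∈S ; via-at = joins⇒∈incident H (inj₁ (refl , refl)) }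
    arrival (suc t) = proj₁ (depart (arrival t))

module _ {H : Graph} {S : EdgeSet H} (w : NonBacktrackingWalk H S) where
  open NonBacktrackingWalk w

  closed-walk-length≥3 : ∀ i k → vertex (suc k + i) ≡ vertex i → 3 ≤ suc k
  closed-walk-length≥3 i zero closes =
    ⊥-elim (joins-irreflexive H (subst (Joins H (edge i) (vertex i)) closes (edge-joins i)))
  closed-walk-length≥3 i (suc zero) closes =
    ⊥-elim (no-backtrack i (joins-unique H back-to-i (edge-joins i)))
    where
    back-to-i : Joins H (edge (suc i)) (vertex i) (vertex (suc i))
    back-to-i = joins-sym H (subst (Joins H (edge (suc i)) (vertex (suc i))) closes (edge-joins (suc i)))
  closed-walk-length≥3 i (suc (suc k)) closes = s≤s (s≤s (s≤s z≤n))

  walk⇒cycle : ∃ λ k → Σ (Cycle H k) λ D → cycleEdges D ⊆ S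
  walk⇒cycle
    with i , j , i<j , vi≡vj , injective-below ← first-repetition vertex
    with k , refl ← <⇒≡suc+ i<j
    = k , D , cycleEdges⊆ D (λ a → edge∈S (toℕ a + i))
    where
    closes : vertex (suc k + i) ≡ vertex i
    closes = sym vi≡vj

    offset< : ∀ (a : Fin (suc k)) → toℕ a + i < suc k + i
    offset< a = +-monoˡ-< i (toℕ<n a)

    step-to-next : ∀ a → vertex (suc (toℕ a + i)) ≡ vertex (toℕ (next a) + i)
    step-to-next a with nextView a
    ... | step _ a′ = cong (λ t → vertex (t + i)) (sym a′)
    ... | wrap a≡k a′ =
      trans (cong (λ t → vertex (suc t + i)) a≡k) (trans closes (cong (λ t → vertex (t + i)) (sym a′)))

    D : Cycle H k
    D = record
      { len≥3    = closed-walk-length≥3 i k closes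
      ; vert     = λ a → vertex (toℕ a + i)
      ; distinct = λ {a} {b} eq →
          toℕ-injective (+-cancelʳ-≡ i _ _ (injective-below (offset< a) (offset< b) eq))
      ; adj      = λ a → edge (toℕ a + i) , subst (Joins H _ _) (step-to-next a) (edge-joins (toℕ a + i))
      }

module _ (H : Graph) (k : ℕ)
         (odd-cycles-long : ∀ k′ → Cycle H k′ → Odd (suc k′) → suc k ≤ suc k′) where

  odd-Eulerian⇒long : ∀ S → Eulerian H S → Odd ∣ S ∣ → suc k ≤ ∣ S ∣
  odd-Eulerian⇒long S = go S (<-wellFounded ∣ S ∣)
    where
    go : ∀ S → Acc _<_ ∣ S ∣ → Eulerian H S → Odd ∣ S ∣ → suc k ≤ ∣ S ∣
    go S (acc smaller) S-Eulerian S-odd with nonempty? S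
    ... | no empty =
      ⊥-elim (S-odd (subst (2 ∣_) (sym (trans (cong ∣_∣ (Empty-unique empty)) (∣⊥∣≡0 (m H)))) (2 ∣0)))
    ... | yes (e , e∈S) with walk⇒cycle (Eulerian⇒walk H S S-Eulerian e∈S)
    ... | k′ , D , D⊆S with 2 ∣? suc k′
    ... | no D-odd =
      ≤-trans (odd-cycles-long k′ D D-odd) (subst (_≤ ∣ S ∣) (∣cycleEdges∣≡length D) (p⊆q⇒∣p∣≤∣q∣ D⊆S))
    ... | yes D-even = ≤-trans (go S′ (smaller S′<S) S′-Eulerian S′-odd) (<⇒≤ S′<S)
      where
      S′ : EdgeSet H
      S′ = S ⊕ cycleEdges D
      ∣S′∣+∣D∣≡∣S∣ : ∣ S′ ∣ + suc k′ ≡ ∣ S ∣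
      ∣S′∣+∣D∣≡∣S∣ = subst (λ l → ∣ S′ ∣ + l ≡ ∣ S ∣) (∣cycleEdges∣≡length D) (⊆⇒∣p⊕q∣+∣q∣≡∣p∣ D⊆S)
      S′<S : ∣ S′ ∣ < ∣ S ∣
      S′<S = subst (∣ S′ ∣ <_) ∣S′∣+∣D∣≡∣S∣ (m<m+n ∣ S′ ∣ (s≤s z≤n))
      S′-Eulerian : Eulerian H S′
      S′-Eulerian = Eulerian-⊕ H S (cycleEdges D) S-Eulerian (cycleEdges-Eulerian D)
      S′-odd : Odd ∣ S′ ∣
      S′-odd 2∣S′ = S-odd (subst (2 ∣_) ∣S′∣+∣D∣≡∣S∣ (∣m∣n⇒∣m+n 2∣S′ D-even))

proposition4p7 : (H : Graph) (k : ℕ) (C : Cycle H k) → ShortestOddCycle H k C →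
    (X Y : EdgeSet H) → Eulerian H X → Eulerian H Y → ∣ X ∣ % 2 ≡ ∣ Y ∣ % 2 →
    ∣ Y ∣ ≤ ∣ X ∣ + 2 * ∣ (Y ─ cycleEdges C) ─ (X ─ cycleEdges C) ∣
proposition4p7 H k C (C-odd , odd-cycles-long) X Y X-Eulerian Y-Eulerian ∣X∣≡∣Y∣ =
  +-cancelʳ-≤ ∣ W ∣ ∣ Y ∣ _ (begin
    ∣ Y ∣ + ∣ W ∣                                 ≤⟨ ∣q∣+∣p⊕q⊕r∣≤∣p∣+2∣q─r─[p─r]∣+∣r∣ X Y E ⟩
    ∣ X ∣ + 2 * ∣ Y ─ E ─ (X ─ E) ∣ + ∣ E ∣        ≤⟨ +-monoʳ-≤ (∣ X ∣ + 2 * ∣ Y ─ E ─ (X ─ E) ∣) ∣E∣≤∣W∣ ⟩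
    ∣ X ∣ + 2 * ∣ Y ─ E ─ (X ─ E) ∣ + ∣ W ∣        ∎)
  where
  open ≤-Reasoning
  E W : EdgeSet H
  E = cycleEdges C
  W = X ⊕ Y ⊕ E
  W-Eulerian : Eulerian H W
  W-Eulerian =
    Eulerian-⊕ H (X ⊕ Y) E (Eulerian-⊕ H X Y X-Eulerian Y-Eulerian) (cycleEdges-Eulerian C)
  W-odd : Odd ∣ W ∣
  W-odd 2∣W = C-odd (subst (2 ∣_) (∣cycleEdges∣≡length C)
    (∣m+n∣m⇒∣n (Equivalence.to (2∣∣p⊕q∣⇔2∣∣p∣+∣q∣ (X ⊕ Y) E) 2∣W)
               (Equivalence.from (2∣∣p⊕q∣⇔2∣∣p∣+∣q∣ X Y) (m%2≡n%2⇒2∣m+n ∣ X ∣ ∣ Y ∣ ∣X∣≡∣Y∣))))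
  ∣E∣≤∣W∣ : ∣ E ∣ ≤ ∣ W ∣
  ∣E∣≤∣W∣ = subst (_≤ ∣ W ∣) (sym (∣cycleEdges∣≡length C))
    (odd-Eulerian⇒long H k odd-cycles-long W W-Eulerian W-odd)
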